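{- For every integer $k\geq 2$ there exist infinitely many $(2k+1)$-ordered simple graphs $G$ such that, writing $n$ for the number of vertices of $G$, the diameter of $G$ equals $\left\lfloor \frac{n-3}{2k}\right\rfloor+1$.
   Context: A simple graph $G$ is $r$-ordered if, for every sequence $v_1, \ldots, v_r$ of $r$ distinct vertices of $G$, there exists a cycle in $G$ containing $v_1, \ldots, v_r$ in this (cyclic) order. -}

module Defs where

open import Data.Nat using (ℕ; zero; suc; _+_; _*_; _∸_; _≤_; _<_; _/_; _%_)
open import Data.Fin using (Fin; toℕ)
open import Data.Product using (Σ; ∃; _×_; _,_)
open import Data.Sum using (_⊎_)
open import Function.Definitions using (Injective)
open import Relation.Binary.PropositionalEquality using (_≡_)
open import Relation.Nullary using (¬_)

_div_ : ℕ → ℕ → ℕ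
m div zero    = zero
m div (suc d) = m / suc d

_mod_ : ℕ → ℕ → ℕ
m mod zero    = m
m mod (suc d) = m % suc d

record SimpleGraph (n : ℕ) : Set₁ where
  field
    Adj    : Fin n → Fin n → Set
    sym    : ∀ {u v} → Adj u v → Adj v u
    irrefl : ∀ {v} → ¬ Adj v v
open SimpleGraph public

data Walk {n : ℕ} (G : SimpleGraph n) : Fin n → Fin n → ℕ → Set where
  nil  : ∀ {v} → Walk G v v zero
  cons : ∀ {u w v ℓ} → Adj G u w → Walk G w v ℓ → Walk G u v (suc ℓ)

DistLE : {n : ℕ} → SimpleGraph n → Fin n → Fin n → ℕ → Set
DistLE G u v d = ∃ λ ℓ → ℓ ≤ d × Walk G u v ℓ

HasDiameter : {n : ℕ} → SimpleGraph n → ℕ → Set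
HasDiameter {n} G d =
  (∀ u v → DistLE G u v d) ×
  (∃ λ u → ∃ λ v → ∀ ℓ → ℓ < d → ¬ Walk G u v ℓ)

record Cycle {n : ℕ} (G : SimpleGraph n) : Set where
  field
    len      : ℕ
    len≥3    : 3 ≤ len
    vert     : Fin len → Fin n
    distinct : Injective _≡_ _≡_ vert
    adjNext  : ∀ (i j : Fin len) → toℕ j ≡ suc (toℕ i) mod len →
               Adj G (vert i) (vert j)
open Cycle public

-- The cycle C contains v 0, …, v (r-1) in this cyclic order (along the
-- traversal direction of C): there are positions p j on C with vert (p j) = v j,
-- and a rotation s of the cycle after which the positions strictly increase.
ContainsInCyclicOrder : {n r : ℕ} {G : SimpleGraph n} →
                        Cycle G → (Fin r → Fin n) → Set
ContainsInCyclicOrder {r = r} C v =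
  Σ (Fin r → Fin (len C)) λ p →
    (∀ j → vert C (p j) ≡ v j) ×
    (∃ λ s → ∀ (i j : Fin r) → toℕ i < toℕ j →
       (toℕ (p i) + s) mod len C < (toℕ (p j) + s) mod len C)

Ordered : {n : ℕ} → ℕ → SimpleGraph n → Set
Ordered {n} r G =
  ∀ (v : Fin r → Fin n) → Injective _≡_ _≡_ v →
    Σ (Cycle G) λ C → ContainsInCyclicOrder C v

module Submission where

-- Put the vertices in layers 0, 1, …, m + 1 of sizes 1, 2k, …, 2k, 2 and join two distinct
-- vertices when their layers differ by at most one; the diameter is then the number
-- m + 1 = ⌊(n − 3)/2k⌋ + 1 of steps between the two outer layers. Given distinct vertices
-- v₀, …, v₂ₖ, route each v_i to v_{i+1} (indices mod 2k + 1) through one vertex outside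
-- {v₀, …, v₂ₖ} on every layer strictly between theirs. A crossed layer ℓ has enough such free
-- vertices: if some index neither crosses ℓ nor has v_i on ℓ, then the crossings plus the v_i
-- on ℓ number at most 2k, the size of ℓ; otherwise either nothing crosses ℓ, or everything does
-- and the v_i alternate between the two sides of ℓ around a cycle of odd length, which is
-- impossible. Using distinct free vertices for distinct crossings, the concatenated routes
-- form a cycle through v₀, …, v₂ₖ in this order.

open import Data.Bool using (Bool; not)
open import Data.Bool.Properties using (not-involutive; not-¬)
open import Data.Empty using (⊥-elim)
open import Data.Fin using (Fin; zero; suc; toℕ; inject₁; inject≤; fromℕ; fromℕ<)
open import Data.Fin.Induction using (<-weakInduction; <-weakInduction-startingFrom)
open import Data.Fin.Properties
  using (toℕ-injective; toℕ<n; toℕ-inject₁; toℕ-fromℕ; toℕ-fromℕ<; ≤fromℕ; inject≤-injective;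
         injective⇒≤; any?; all?; ¬∀⟶∃¬)
import Data.Fin.Properties as Fin
open import Data.Fin.Relation.Unary.Top using (view; ‵fromℕ; ‵inj₁; view-fromℕ; view-inject₁)
open import Data.List
  using (List; []; _∷_; _++_; [_]; length; map; lookup; concat; tabulate; filter; allFin; applyDownFrom)
open import Data.List.Membership.Propositional using (_∈_; mapWith∈)
open import Data.List.Membership.Propositional.Properties
  using (∈-lookup; ∈-filter⁺; ∈-filter⁻; ∈-allFin; ∈-tabulate⁻; ∈-map⁺; ∈-++⁺ˡ; ∈-++⁺ʳ;
         ∈-++⁻; map-mapWith∈; mapWith∈-cong; mapWith∈-id)
open import Data.List.Properties
  using (map-++; ++-assoc; ++-identityʳ; length-++; length-map; length-tabulate; filter-notAll; filter-none)
open import Data.List.Relation.Binary.Disjoint.Propositional using (Disjoint)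
open import Data.List.Relation.Binary.Subset.Propositional using (_⊆_)
open import Data.List.Relation.Unary.All as All using (All; []; _∷_)
import Data.List.Relation.Unary.All.Properties as All
open import Data.List.Relation.Unary.AllPairs using ([]; _∷_)
import Data.List.Relation.Unary.AllPairs.Properties as AllPairs
open import Data.List.Relation.Unary.Any as Any using (Any; here; there; index)
open import Data.List.Relation.Unary.Any.Properties using (lookup-index; ++⁺ʳ; mapWith∈⁻)
open import Data.List.Relation.Unary.Linked using (Linked; [-]; _∷_)
import Data.List.Relation.Unary.Linked.Properties as Linked
open import Data.List.Relation.Unary.Unique.Propositional using (Unique)
import Data.List.Relation.Unary.Unique.Propositional.Properties as Unique
open import Data.Nat using (ℕ; zero; suc; _+_; _*_; _∸_; _/_; _%_; _≤_; _<_; z≤n; s≤s; _≟_; _<?_)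
open import Data.Nat.DivMod using (m<n⇒m%n≡m; n%n≡0; m<n⇒m/n≡0; m*n/n≡m; +-distrib-/-∣ʳ; /-monoˡ-≤)
open import Data.Nat.Divisibility using (divides)
open import Data.Nat.GeneralisedArithmetic using (fold)
open import Data.Nat.Properties
  using (suc-injective; 1+n≢n; n≤1+n; n<1+n; m≤n⇒m≤1+n; m≤n⇒m≤o+n; m≤m+n; m≤n+m; m≤m*n;
         ≤-refl; ≤-reflexive; ≤-trans; ≤-antisym; ≤-pred; <-trans; <-asym; <-cmp;
         <⇒≢; >⇒≢; <⇒≱; ≮⇒≥;
         +-comm; +-suc; +-identityʳ; *-suc; m∸n+n≡m; +-cancelʳ-≡; +-cancelʳ-≤;
         +-monoˡ-≤; +-monoʳ-≤; +-monoˡ-<; +-monoʳ-<; *-monoˡ-≤; *-monoʳ-≤; module ≤-Reasoning)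
open import Data.Nat.Tactic.RingSolver using (solve-∀)
open import Data.Product using (Σ; ∃; _×_; _,_; proj₁; proj₂; swap)
open import Data.Sum using (_⊎_; inj₁; inj₂; [_,_]′)
open import Defs hiding (sym)
open import Function using (_∘_; id; _on_)
open import Function.Definitions using (Injective)
open import Level using (0ℓ)
open import Relation.Binary using (tri<; tri≈; tri>)
open import Relation.Binary.PropositionalEquality
  using (_≡_; _≢_; refl; sym; trans; cong; cong₂; subst; subst₂; module ≡-Reasoning)
open import Relation.Nullary using (¬_; ¬?; Dec; yes; no; does; _×-dec_; _⊎-dec_)
open import Relation.Nullary.Decidable using (dec-true; dec-false; decidable-stable)
open import Relation.Unary using (Pred)

private
  variable
    A B : Set

lookup-injective : {xs : List A} → Unique xs → ∀ {i j} → lookup xs i ≡ lookup xs j → i ≡ j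
lookup-injective (_    ∷ _)   {zero}  {zero}  _  = refl
lookup-injective (x∉xs ∷ _)   {zero}  {suc j} eq = ⊥-elim (All.lookup x∉xs (∈-lookup j) eq)
lookup-injective (x∉xs ∷ _)   {suc i} {zero}  eq = ⊥-elim (All.lookup x∉xs (∈-lookup i) (sym eq))
lookup-injective (_    ∷ xs!) {suc i} {suc j} eq = cong suc (lookup-injective xs! eq)

unique-⊆⇒length≤ : {xs ys : List A} → Unique xs → xs ⊆ ys → length xs ≤ length ys
unique-⊆⇒length≤ {xs = xs} {ys} xs! xs⊆ys = injective⇒≤ position-injective
  where
  position : Fin (length xs) → Fin (length ys)
  position i = index (xs⊆ys (∈-lookup i))

  position-injective : ∀ {i j} → position i ≡ position j → i ≡ j
  position-injective {i} {j} eq = lookup-injective xs! (begin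
    lookup xs i             ≡⟨ lookup-index (xs⊆ys (∈-lookup i)) ⟩
    lookup ys (position i)  ≡⟨ cong (lookup ys) eq ⟩
    lookup ys (position j)  ≡⟨ lookup-index (xs⊆ys (∈-lookup j)) ⟨
    lookup xs j             ∎)
    where open ≡-Reasoning

module _ {xs : List A} {ys : List B} (fits : length xs ≤ length ys) where

  embed : ∀ {x} → x ∈ xs → B
  embed x∈xs = lookup ys (inject≤ (index x∈xs) fits)

  embed-∈ : ∀ {x} (x∈xs : x ∈ xs) → embed x∈xs ∈ ys
  embed-∈ x∈xs = ∈-lookup _

  embed-injective : Unique ys → ∀ {x y} (x∈xs : x ∈ xs) (y∈xs : y ∈ xs) →
                    embed x∈xs ≡ embed y∈xs → x ≡ y
  embed-injective ys! {x} {y} x∈xs y∈xs eq = begin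
    x                       ≡⟨ lookup-index x∈xs ⟩
    lookup xs (index x∈xs)  ≡⟨ cong (lookup xs) index-eq ⟩
    lookup xs (index y∈xs)  ≡⟨ lookup-index y∈xs ⟨
    y                       ∎
    where
    open ≡-Reasoning
    index-eq : index x∈xs ≡ index y∈xs
    index-eq = inject≤-injective fits fits _ _ (lookup-injective ys! eq)

module _ {R : A → A → Set} where

  Linked-join : ∀ xs {y ys} → Linked R (xs ++ [ y ]) → Linked R (y ∷ ys) → Linked R (xs ++ y ∷ ys)
  Linked-join []           _          y∷ys = y∷ys
  Linked-join (_ ∷ [])     (r ∷ _)    y∷ys = r ∷ y∷ys
  Linked-join (_ ∷ x ∷ xs) (r ∷ rest) y∷ys = r ∷ Linked-join (x ∷ xs) rest y∷ys

  Linked-lookup-suc : ∀ xs {z} → Linked R (xs ++ [ z ]) →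
                      ∀ {i j} → toℕ j ≡ suc (toℕ i) → R (lookup xs i) (lookup xs j)
  Linked-lookup-suc (_ ∷ [])     _          {zero}  {zero}        ()
  Linked-lookup-suc (_ ∷ _ ∷ _)  _          {zero}  {zero}        ()
  Linked-lookup-suc (_ ∷ _ ∷ _)  (r ∷ _)    {zero}  {suc zero}    _  = r
  Linked-lookup-suc (_ ∷ _ ∷ _)  _          {zero}  {suc (suc _)} ()
  Linked-lookup-suc (_ ∷ _ ∷ _)  _          {suc _} {zero}        ()
  Linked-lookup-suc (_ ∷ x ∷ xs) (_ ∷ rest) {suc _} {suc _}       eq =
    Linked-lookup-suc (x ∷ xs) rest (suc-injective eq)

  Linked-lookup-last : ∀ xs {z} → Linked R (xs ++ [ z ]) →
                       ∀ {i} → suc (toℕ i) ≡ length xs → R (lookup xs i) z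
  Linked-lookup-last (_ ∷ [])     (r ∷ _)    {zero}  _  = r
  Linked-lookup-last (_ ∷ _ ∷ _)  _          {zero}  ()
  Linked-lookup-last (_ ∷ x ∷ xs) (_ ∷ rest) {suc _} eq = Linked-lookup-last (x ∷ xs) rest (suc-injective eq)

chain : ∀ {r} → (Fin r → A) → (Fin r → List A) → List A
chain h t = concat (tabulate (λ i → h i ∷ t i))

OccursInOrder : ∀ {r} → (Fin r → A) → List A → Set
OccursInOrder v xs =
  Σ (∀ j → v j ∈ xs) λ occ → ∀ i j → toℕ i < toℕ j → toℕ (index (occ i)) < toℕ (index (occ j))

toℕ-index-++⁺ʳ : ∀ {P : Pred A 0ℓ} xs {ys} (p : Any P ys) →
                 toℕ (index (++⁺ʳ xs p)) ≡ length xs + toℕ (index p)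
toℕ-index-++⁺ʳ []       p = refl
toℕ-index-++⁺ʳ (_ ∷ xs) p = cong suc (toℕ-index-++⁺ʳ xs p)

chain-occurs : ∀ {r} (h : Fin r → A) t → OccursInOrder h (chain h t)
chain-occurs {r = zero}  h t = (λ ()) , λ ()
chain-occurs {r = suc r} h t = occ , increasing
  where
  rest = chain-occurs (h ∘ suc) (t ∘ suc)

  occ : ∀ j → h j ∈ chain h t
  occ zero    = here refl
  occ (suc j) = there (++⁺ʳ (t zero) (proj₁ rest j))

  increasing : ∀ i j → toℕ i < toℕ j → toℕ (index (occ i)) < toℕ (index (occ j))
  increasing zero    (suc j) _         = s≤s z≤n
  increasing (suc i) (suc j) (s≤s i<j) = s≤s (subst₂ _<_
    (sym (toℕ-index-++⁺ʳ (t zero) (proj₁ rest i))) (sym (toℕ-index-++⁺ʳ (t zero) (proj₁ rest j)))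
    (+-monoʳ-< (length (t zero)) (proj₂ rest i j i<j)))

cyclicSuc : ∀ {m} → Fin (suc m) → Fin (suc m)
cyclicSuc i with view i
... | ‵fromℕ          = zero
... | ‵inj₁ {i = j} _ = suc j

cyclicSuc-inject₁ : ∀ {m} (i : Fin m) → cyclicSuc (inject₁ i) ≡ suc i
cyclicSuc-inject₁ i rewrite view-inject₁ i = refl

cyclicSuc-fromℕ : ∀ m → cyclicSuc (fromℕ m) ≡ zero
cyclicSuc-fromℕ m rewrite view-fromℕ m = refl

cyclicSuc-closed⇒all : ∀ {m} (P : Pred (Fin (suc m)) 0ℓ) → (∀ i → P i → P (cyclicSuc i)) →
                       ∀ {i} → P i → ∀ j → P j
cyclicSuc-closed⇒all {m} P step {i} Pi = <-weakInduction P P₀ step′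
  where
  step′ : ∀ j → P (inject₁ j) → P (suc j)
  step′ j = subst P (cyclicSuc-inject₁ j) ∘ step (inject₁ j)

  P₀ : P zero
  P₀ = subst P (cyclicSuc-fromℕ m) (step _ (<-weakInduction-startingFrom P Pi step′ (≤fromℕ i)))

fold-not-even : ∀ h b → fold b not (2 * h) ≡ b
fold-not-even zero    b = refl
fold-not-even (suc h) b = begin
  fold b not (2 * suc h)          ≡⟨ cong (fold b not) (*-suc 2 h) ⟩
  not (not (fold b not (2 * h)))  ≡⟨ not-involutive _ ⟩
  fold b not (2 * h)              ≡⟨ fold-not-even h b ⟩
  b                               ∎
  where open ≡-Reasoning

odd-cycle-not-alternating : ∀ h (c : Fin (suc (2 * h)) → Bool) → ¬ (∀ i → c (cyclicSuc i) ≡ not (c i))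
odd-cycle-not-alternating h c alternating = not-¬ c₀≡c-top (begin
  c zero                          ≡⟨ cong c (cyclicSuc-fromℕ (2 * h)) ⟨
  c (cyclicSuc (fromℕ (2 * h)))   ≡⟨ alternating (fromℕ (2 * h)) ⟩
  not (c (fromℕ (2 * h)))         ∎)
  where
  open ≡-Reasoning

  parity : ∀ i → c i ≡ fold (c zero) not (toℕ i)
  parity = <-weakInduction _ refl λ j c-j → begin
    c (suc j)                                  ≡⟨ cong c (cyclicSuc-inject₁ j) ⟨
    c (cyclicSuc (inject₁ j))                  ≡⟨ alternating (inject₁ j) ⟩
    not (c (inject₁ j))                        ≡⟨ cong not c-j ⟩
    not (fold (c zero) not (toℕ (inject₁ j)))  ≡⟨ cong (not ∘ fold (c zero) not) (toℕ-inject₁ j) ⟩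
    fold (c zero) not (toℕ (suc j))            ∎

  c₀≡c-top : c zero ≡ c (fromℕ (2 * h))
  c₀≡c-top = begin
    c zero                                   ≡⟨ fold-not-even h (c zero) ⟨
    fold (c zero) not (2 * h)                ≡⟨ cong (fold (c zero) not) (toℕ-fromℕ (2 * h)) ⟨
    fold (c zero) not (toℕ (fromℕ (2 * h)))  ≡⟨ parity (fromℕ (2 * h)) ⟨
    c (fromℕ (2 * h))                        ∎

module _ {R : A → A → Set} where

  private
    chain-linked′ : ∀ {m} (h : Fin (suc m) → A) t {z} →
                    (∀ i → Linked R (h (inject₁ i) ∷ t (inject₁ i) ++ [ h (suc i) ])) →
                    Linked R (h (fromℕ m) ∷ t (fromℕ m) ++ [ z ]) →
                    Linked R (chain h t ++ [ z ])
    chain-linked′ {zero}  h t {z} _ last =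
      subst (λ xs → Linked R (xs ++ [ z ])) (sym (++-identityʳ (h zero ∷ t zero))) last
    chain-linked′ {suc m} h t {z} step last =
      subst (Linked R) (sym (++-assoc (h zero ∷ t zero) (chain (h ∘ suc) (t ∘ suc)) [ z ]))
        (Linked-join (h zero ∷ t zero) (step zero) (chain-linked′ (h ∘ suc) (t ∘ suc) (step ∘ suc) last))

  chain-linked : ∀ {m} (h : Fin (suc m) → A) t →
                 (∀ i → Linked R (h i ∷ t i ++ [ h (cyclicSuc i) ])) →
                 Linked R (chain h t ++ [ h zero ])
  chain-linked {m} h t links = chain-linked′ h t
    (λ i → subst (λ j → Linked R (h (inject₁ i) ∷ t (inject₁ i) ++ [ h j ]))
                 (cyclicSuc-inject₁ i) (links (inject₁ i)))
    (subst (λ j → Linked R (h (fromℕ m) ∷ t (fromℕ m) ++ [ h j ])) (cyclicSuc-fromℕ m) (links (fromℕ m)))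

-- Cycles from closed lists

module _ {n} (G : SimpleGraph n) {R : Fin n → Fin n → Set}
         (adjacent : ∀ {x y} → x ≢ y → R x y → Adj G x y) where

  cycleOf : ∀ x xs → 3 ≤ length (x ∷ xs) → Unique (x ∷ xs) → Linked R (x ∷ xs ++ [ x ]) → Cycle G
  cycleOf x xs len≥3 ys! closed = record
    { len      = length ys
    ; len≥3    = len≥3
    ; vert     = lookup ys
    ; distinct = lookup-injective ys!
    ; adjNext  = successor-adjacent
    }
    where
    ys = x ∷ xs

    distinct-at : ∀ {i j} → toℕ i ≢ toℕ j → lookup ys i ≢ lookup ys j
    distinct-at i≢j = i≢j ∘ cong toℕ ∘ lookup-injective ys!

    successor-adjacent : ∀ i j → toℕ j ≡ suc (toℕ i) mod length ys → Adj G (lookup ys i) (lookup ys j)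
    successor-adjacent i j j≡i+1 with suc (toℕ i) <? length ys
    ... | yes i+1<len =
      adjacent (distinct-at (<⇒≢ (≤-reflexive (sym j≡i+1′)))) (Linked-lookup-suc ys closed j≡i+1′)
      where j≡i+1′ = trans j≡i+1 (m<n⇒m%n≡m i+1<len)
    ... | no  i+1≮len = subst (λ k → Adj G (lookup ys i) (lookup ys k)) (sym j≡0)
                          (adjacent (distinct-at i≢0) (Linked-lookup-last ys closed i-last))
      where
      i-last : suc (toℕ i) ≡ length ys
      i-last = ≤-antisym (toℕ<n i) (≮⇒≥ i+1≮len)

      j≡0 : j ≡ zero
      j≡0 = toℕ-injective (trans j≡i+1 (trans (cong (_% length ys) i-last) (n%n≡0 (length ys))))

      i≢0 : toℕ i ≢ 0
      i≢0 i≡0 with s≤s () ← subst (3 ≤_) (trans (sym i-last) (cong suc i≡0)) len≥3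

  cycleThrough : ∀ {r} (v : Fin r → Fin n) → Injective _≡_ _≡_ v → 3 ≤ r →
                 ∀ {x xs} → Unique (x ∷ xs) → Linked R (x ∷ xs ++ [ x ]) → OccursInOrder v (x ∷ xs) →
                 Σ (Cycle G) λ C → ContainsInCyclicOrder C v
  cycleThrough v v-injective r≥3 {x} {xs} ys! closed (occ , increasing) =
    cycleOf x xs (≤-trans r≥3 (injective⇒≤ position-injective)) ys! closed ,
    position , (λ j → sym (lookup-index (occ j))) , 0 ,
    λ i j i<j → subst₂ _<_ (sym (unrotated i)) (sym (unrotated j)) (increasing i j i<j)
    where
    position : ∀ j → Fin (length (x ∷ xs))
    position j = index (occ j)

    position-injective : ∀ {i j} → position i ≡ position j → i ≡ j
    position-injective {i} {j} eq = v-injective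
      (trans (lookup-index (occ i)) (trans (cong (lookup (x ∷ xs)) eq) (sym (lookup-index (occ j)))))

    unrotated : ∀ j → (toℕ (position j) + 0) mod length (x ∷ xs) ≡ toℕ (position j)
    unrotated j = trans (cong (_% length (x ∷ xs)) (+-identityʳ (toℕ (position j))))
                        (m<n⇒m%n≡m (toℕ<n (position j)))

-- Layered graphs

Close : ℕ → ℕ → Set
Close p q = p ≤ suc q × q ≤ suc p

close-suc : ∀ p → Close p (suc p)
close-suc p = m≤n⇒m≤1+n (n≤1+n p) , ≤-refl

close-pred : ∀ p → Close (suc p) p
close-pred p = swap (close-suc p)

layered : ∀ {n} → (Fin n → ℕ) → SimpleGraph n
layered lay = record
  { Adj    = λ x y → x ≢ y × Close (lay x) (lay y)
  ; sym    = λ (x≢y , close) → x≢y ∘ sym , swap close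
  ; irrefl = λ (x≢x , _) → x≢x refl
  }

layer : ∀ {n} → (Fin n → ℕ) → ℕ → List (Fin n)
layer {n} lay ℓ = filter (λ x → lay x ≟ ℓ) (allFin n)

∈-layer⁻ : ∀ {n} {lay : Fin n → ℕ} {ℓ x} → x ∈ layer lay ℓ → lay x ≡ ℓ
∈-layer⁻ {n} {lay} {ℓ} = proj₂ ∘ ∈-filter⁻ (λ y → lay y ≟ ℓ) {xs = allFin n}

Between : ℕ → ℕ → ℕ → Set
Between a b ℓ = (a < ℓ × ℓ < b) ⊎ (b < ℓ × ℓ < a)

between? : ∀ a b ℓ → Dec (Between a b ℓ)
between? a b ℓ = ((a <? ℓ) ×-dec (ℓ <? b)) ⊎-dec ((b <? ℓ) ×-dec (ℓ <? a))

between⇒≢ˡ : ∀ {a b ℓ} → Between a b ℓ → a ≢ ℓ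
between⇒≢ˡ (inj₁ (a<ℓ , _)) = <⇒≢ a<ℓ
between⇒≢ˡ (inj₂ (_ , ℓ<a)) = >⇒≢ ℓ<a

between⇒≢ʳ : ∀ {a b ℓ} → Between a b ℓ → b ≢ ℓ
between⇒≢ʳ (inj₁ (_ , ℓ<b)) = >⇒≢ ℓ<b
between⇒≢ʳ (inj₂ (b<ℓ , _)) = <⇒≢ b<ℓ

between-sides : ∀ {a b ℓ} → Between a b ℓ → does (b <? ℓ) ≡ not (does (a <? ℓ))
between-sides {a} {b} {ℓ} (inj₁ (a<ℓ , ℓ<b)) =
  trans (dec-false (b <? ℓ) (<-asym ℓ<b)) (cong not (sym (dec-true (a <? ℓ) a<ℓ)))
between-sides {a} {b} {ℓ} (inj₂ (b<ℓ , ℓ<a)) =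
  trans (dec-true (b <? ℓ) b<ℓ) (cong not (sym (dec-false (a <? ℓ) (<-asym ℓ<a))))

ascending : ℕ → ℕ → List ℕ
ascending a zero    = []
ascending a (suc d) = suc a ∷ ascending (suc a) d

descending : ℕ → ℕ → List ℕ
descending b = applyDownFrom (_+ suc b)

ascending-linked : ∀ a d → Linked Close (a ∷ ascending a d ++ [ d + suc a ])
ascending-linked a zero    = close-suc a ∷ [-]
ascending-linked a (suc d) = close-suc a ∷ subst (λ c → Linked Close (suc a ∷ ascending (suc a) d ++ [ c ]))
                                                 (+-suc d (suc a)) (ascending-linked (suc a) d)

descending-linked : ∀ b d → Linked Close (d + suc b ∷ descending b d ++ [ b ])
descending-linked b zero    = close-pred b ∷ [-]
descending-linked b (suc d) = close-pred (d + suc b) ∷ descending-linked b d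

ascending-bounds : ∀ a d → All (λ ℓ → a < ℓ × ℓ < d + suc a) (ascending a d)
ascending-bounds a zero    = []
ascending-bounds a (suc d) = (n<1+n a , s≤s (m≤n+m (suc a) d)) ∷
  All.map (λ {ℓ} (a+1<ℓ , ℓ<d+a+2) → <-trans (n<1+n a) a+1<ℓ , subst (ℓ <_) (+-suc d (suc a)) ℓ<d+a+2)
          (ascending-bounds (suc a) d)

descending-bounds : ∀ b d → All (λ ℓ → b < ℓ × ℓ < d + suc b) (descending b d)
descending-bounds b d =
  All.applyDownFrom⁺₁ (_+ suc b) d (λ {i} i<d → m≤n+m (suc b) i , +-monoˡ-< (suc b) i<d)

ascending-unique : ∀ a d → Unique (ascending a d)
ascending-unique a zero    = []
ascending-unique a (suc d) = All.map (λ (a+1<ℓ , _) → <⇒≢ a+1<ℓ) (ascending-bounds (suc a) d)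
                           ∷ ascending-unique (suc a) d

descending-unique : ∀ b d → Unique (descending b d)
descending-unique b d = Unique.applyDownFrom⁺₁ (_+ suc b) d (λ j<i _ → >⇒≢ (+-monoˡ-< (suc b) j<i))

layersBetween : ℕ → ℕ → List ℕ
layersBetween a b with <-cmp a b
... | tri< _ _ _ = ascending a (b ∸ suc a)
... | tri≈ _ _ _ = []
... | tri> _ _ _ = descending b (a ∸ suc b)

layersBetween-linked : ∀ a b → Linked Close (a ∷ layersBetween a b ++ [ b ])
layersBetween-linked a b with <-cmp a b
... | tri< a<b _ _  = subst (λ c → Linked Close (a ∷ ascending a (b ∸ suc a) ++ [ c ]))
                            (m∸n+n≡m a<b) (ascending-linked a (b ∸ suc a))
... | tri≈ _ refl _ = (n≤1+n a , n≤1+n a) ∷ [-]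
... | tri> _ _ b<a  = subst (λ c → Linked Close (c ∷ descending b (a ∸ suc b) ++ [ b ]))
                            (m∸n+n≡m b<a) (descending-linked b (a ∸ suc b))

layersBetween-between : ∀ a b → All (Between a b) (layersBetween a b)
layersBetween-between a b with <-cmp a b
... | tri< a<b _ _ = All.map (λ {ℓ} (a<ℓ , ℓ<b) → inj₁ (a<ℓ , subst (ℓ <_) (m∸n+n≡m a<b) ℓ<b))
                             (ascending-bounds a (b ∸ suc a))
... | tri≈ _ _ _   = []
... | tri> _ _ b<a = All.map (λ {ℓ} (b<ℓ , ℓ<a) → inj₂ (b<ℓ , subst (ℓ <_) (m∸n+n≡m b<a) ℓ<a))
                             (descending-bounds b (a ∸ suc b))

layersBetween-unique : ∀ a b → Unique (layersBetween a b)
layersBetween-unique a b with <-cmp a b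
... | tri< _ _ _ = ascending-unique a (b ∸ suc a)
... | tri≈ _ _ _ = []
... | tri> _ _ _ = descending-unique b (a ∸ suc b)

-- Routing through the layers

module Routing {n} (lay : Fin n → ℕ) (h : ℕ)
  (thick : ∀ {x y ℓ} → lay x < ℓ → ℓ < lay y → 2 * h ≤ length (layer lay ℓ))
  (v : Fin (suc (2 * h)) → Fin n) (v-injective : Injective _≡_ _≡_ v) where

  height : Fin (suc (2 * h)) → ℕ
  height i = lay (v i)

  Crosses : Fin (suc (2 * h)) → ℕ → Set
  Crosses i = Between (height i) (height (cyclicSuc i))

  crosses? : ∀ i ℓ → Dec (Crosses i ℓ)
  crosses? i = between? (height i) (height (cyclicSuc i))

  Involved : ℕ → Fin (suc (2 * h)) → Set
  Involved ℓ i = Crosses i ℓ ⊎ height i ≡ ℓ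

  involved? : ∀ ℓ i → Dec (Involved ℓ i)
  involved? ℓ i = crosses? i ℓ ⊎-dec (height i ≟ ℓ)

  Occupied : Fin n → Set
  Occupied x = ∃ λ j → v j ≡ x

  occupied? : ∀ x → Dec (Occupied x)
  occupied? x = any? λ j → v j Fin.≟ x

  crossing : ℕ → List (Fin (suc (2 * h)))
  crossing ℓ = filter (λ i → crosses? i ℓ) (allFin _)

  resting : ℕ → List (Fin (suc (2 * h)))
  resting ℓ = filter (λ i → height i ≟ ℓ) (allFin _)

  free : ℕ → List (Fin n)
  free ℓ = filter (λ x → (lay x ≟ ℓ) ×-dec ¬? (occupied? x)) (allFin n)

  ∈-crossing⁺ : ∀ {i ℓ} → Crosses i ℓ → i ∈ crossing ℓ
  ∈-crossing⁺ {i} {ℓ} = ∈-filter⁺ (λ j → crosses? j ℓ) (∈-allFin i)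

  ∈-crossing⁻ : ∀ {i ℓ} → i ∈ crossing ℓ → Crosses i ℓ
  ∈-crossing⁻ {ℓ = ℓ} = proj₂ ∘ ∈-filter⁻ (λ j → crosses? j ℓ) {xs = allFin _}

  ∈-resting⁻ : ∀ {i ℓ} → i ∈ resting ℓ → height i ≡ ℓ
  ∈-resting⁻ {ℓ = ℓ} = proj₂ ∘ ∈-filter⁻ (λ j → height j ≟ ℓ) {xs = allFin _}

  ∈-free⁻ : ∀ {x ℓ} → x ∈ free ℓ → lay x ≡ ℓ × ¬ Occupied x
  ∈-free⁻ {ℓ = ℓ} =
    proj₂ ∘ ∈-filter⁻ (λ x → (lay x ≟ ℓ) ×-dec ¬? (occupied? x)) {xs = allFin n}

  layer⊆free++resting : ∀ ℓ → layer lay ℓ ⊆ free ℓ ++ map v (resting ℓ)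
  layer⊆free++resting ℓ {x} x∈layer with occupied? x
  ... | yes (j , refl) =
    ∈-++⁺ʳ (free ℓ) (∈-map⁺ v (∈-filter⁺ (λ i → height i ≟ ℓ) (∈-allFin j)
                                          (∈-layer⁻ x∈layer)))
  ... | no unoccupied  = ∈-++⁺ˡ (∈-filter⁺ _ (∈-allFin x) (∈-layer⁻ x∈layer , unoccupied))

  crosses⇒2h≤free+resting : ∀ {i ℓ} → Crosses i ℓ → 2 * h ≤ length (free ℓ) + length (resting ℓ)
  crosses⇒2h≤free+resting {i} {ℓ} c = begin
    2 * h                                         ≤⟨ layer-thick c ⟩
    length (layer lay ℓ)                          ≤⟨ unique-⊆⇒length≤ layer-unique
                                                                       (layer⊆free++resting ℓ) ⟩
    length (free ℓ ++ map v (resting ℓ))          ≡⟨ length-++ (free ℓ) ⟩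
    length (free ℓ) + length (map v (resting ℓ))  ≡⟨ cong (length (free ℓ) +_)
                                                          (length-map v (resting ℓ)) ⟩
    length (free ℓ) + length (resting ℓ)          ∎
    where
    open ≤-Reasoning

    layer-thick : Crosses i ℓ → 2 * h ≤ length (layer lay ℓ)
    layer-thick (inj₁ (a<ℓ , ℓ<b)) = thick a<ℓ ℓ<b
    layer-thick (inj₂ (b<ℓ , ℓ<a)) = thick b<ℓ ℓ<a

    layer-unique : Unique (layer lay ℓ)
    layer-unique = Unique.filter⁺ (λ x → lay x ≟ ℓ) (Unique.allFin⁺ n)

  uninvolved⇒crossing+resting≤2h : ∀ {ℓ i} → ¬ Involved ℓ i →
                                   length (crossing ℓ) + length (resting ℓ) ≤ 2 * h
  uninvolved⇒crossing+resting≤2h {ℓ} {i} uninvolved = ≤-pred (begin-strict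
    length (crossing ℓ) + length (resting ℓ)  ≡⟨ length-++ (crossing ℓ) ⟨
    length (crossing ℓ ++ resting ℓ)          ≤⟨ unique-⊆⇒length≤ disjoint-union ⊆involved ⟩
    length (filter (involved? ℓ) (allFin _))  <⟨ filter-notAll (involved? ℓ) (allFin _) i-uninvolved ⟩
    length (allFin (suc (2 * h)))             ≡⟨ length-tabulate id ⟩
    suc (2 * h)                               ∎)
    where
    open ≤-Reasoning

    disjoint-union : Unique (crossing ℓ ++ resting ℓ)
    disjoint-union = Unique.++⁺
      (Unique.filter⁺ (λ j → crosses? j ℓ) (Unique.allFin⁺ _))
      (Unique.filter⁺ (λ j → height j ≟ ℓ) (Unique.allFin⁺ _))
      λ (j∈c , j∈r) → between⇒≢ˡ (∈-crossing⁻ j∈c) (∈-resting⁻ j∈r)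

    ⊆involved : crossing ℓ ++ resting ℓ ⊆ filter (involved? ℓ) (allFin _)
    ⊆involved {j} j∈ = ∈-filter⁺ (involved? ℓ) (∈-allFin j)
      ([ inj₁ ∘ ∈-crossing⁻ , inj₂ ∘ ∈-resting⁻ ]′ (∈-++⁻ (crossing ℓ) j∈))

    i-uninvolved : Any (¬_ ∘ Involved ℓ) (allFin _)
    i-uninvolved = Any.map (λ { refl → uninvolved }) (∈-allFin i)

  -- Being away from ℓ propagates along the cycle of indices, so unless every v_i lies on ℓ,
  -- every segment crosses ℓ and the sides of ℓ alternate around an odd cycle.
  involved⇒resting : ∀ {ℓ} → (∀ i → Involved ℓ i) → ∀ i → height i ≡ ℓ
  involved⇒resting {ℓ} involved i = decidable-stable (height i ≟ ℓ) λ i-away →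
    odd-cycle-not-alternating h side λ j →
      between-sides (crosses (cyclicSuc-closed⇒all Away away-closed i-away j))
    where
    Away : Fin (suc (2 * h)) → Set
    Away j = height j ≢ ℓ

    crosses : ∀ {j} → Away j → Crosses j ℓ
    crosses {j} away with involved j
    ... | inj₁ c    = c
    ... | inj₂ rest = ⊥-elim (away rest)

    away-closed : ∀ j → Away j → Away (cyclicSuc j)
    away-closed j = between⇒≢ʳ ∘ crosses

    side : Fin (suc (2 * h)) → Bool
    side j = does (height j <? ℓ)

  crossing≤free : ∀ ℓ → length (crossing ℓ) ≤ length (free ℓ)
  crossing≤free ℓ with any? (λ i → crosses? i ℓ) | all? (involved? ℓ)
  ... | no none     | _            = subst (λ is → length is ≤ length (free ℓ)) (sym nothing-crosses) z≤n
    where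
    nothing-crosses : crossing ℓ ≡ []
    nothing-crosses = filter-none (λ i → crosses? i ℓ) {xs = allFin _} (All.tabulate λ {i} _ c → none (i , c))
  ... | yes (i , c) | yes involved = ⊥-elim (between⇒≢ˡ c (involved⇒resting involved i))
  ... | yes (i , c) | no not-all with ¬∀⟶∃¬ _ (Involved ℓ) (involved? ℓ) not-all
  ...   | _ , uninvolved = +-cancelʳ-≤ (length (resting ℓ)) _ _
    (≤-trans (uninvolved⇒crossing+resting≤2h uninvolved) (crosses⇒2h≤free+resting c))

  waypoint : ∀ {i ℓ} → Crosses i ℓ → Fin n
  waypoint {ℓ = ℓ} c = embed {ys = free ℓ} (crossing≤free ℓ) (∈-crossing⁺ c)

  waypoint-free : ∀ {i ℓ} (c : Crosses i ℓ) → lay (waypoint c) ≡ ℓ × ¬ Occupied (waypoint c)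
  waypoint-free {ℓ = ℓ} c = ∈-free⁻ (embed-∈ {ys = free ℓ} (crossing≤free ℓ) (∈-crossing⁺ c))

  waypoint-injective : ∀ {i j ℓ ℓ′} (c : Crosses i ℓ) (c′ : Crosses j ℓ′) →
                       waypoint c ≡ waypoint c′ → i ≡ j
  waypoint-injective c c′ eq
    with trans (sym (proj₁ (waypoint-free c))) (trans (cong lay eq) (proj₁ (waypoint-free c′)))
  ... | refl = embed-injective {ys = free _} (crossing≤free _) (Unique.filter⁺ _ (Unique.allFin⁺ n))
                               (∈-crossing⁺ c) (∈-crossing⁺ c′) eq

  crossed : Fin (suc (2 * h)) → List ℕ
  crossed i = layersBetween (height i) (height (cyclicSuc i))

  crossed⇒crosses : ∀ i {ℓ} → ℓ ∈ crossed i → Crosses i ℓ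
  crossed⇒crosses i = All.lookup (layersBetween-between (height i) (height (cyclicSuc i)))

  segment : Fin (suc (2 * h)) → List (Fin n)
  segment i = mapWith∈ (crossed i) (waypoint ∘ crossed⇒crosses i)

  lay-segment : ∀ i → map lay (segment i) ≡ crossed i
  lay-segment i = begin
    map lay (segment i)
      ≡⟨ map-mapWith∈ (crossed i) _ lay ⟩
    mapWith∈ (crossed i) (lay ∘ waypoint ∘ crossed⇒crosses i)
      ≡⟨ mapWith∈-cong (crossed i) _ _ (proj₁ ∘ waypoint-free ∘ crossed⇒crosses i) ⟩
    mapWith∈ (crossed i) (λ {ℓ} _ → ℓ)
      ≡⟨ mapWith∈-id (crossed i) ⟩
    crossed i
      ∎
    where open ≡-Reasoning

  ∈-segment⁻ : ∀ {i x} → x ∈ segment i → ∃ λ ℓ → Σ (Crosses i ℓ) λ c → x ≡ waypoint c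
  ∈-segment⁻ x∈ with mapWith∈⁻ _ _ x∈
  ... | ℓ , _ , eq = ℓ , _ , eq

  segment-unoccupied : ∀ {i x} → x ∈ segment i → ¬ Occupied x
  segment-unoccupied x∈ with ∈-segment⁻ x∈
  ... | _ , c , refl = proj₂ (waypoint-free c)

  chunk-unique : ∀ i → Unique (v i ∷ segment i)
  chunk-unique i = All.tabulate (λ x∈ vi≡x → segment-unoccupied x∈ (i , vi≡x))
                 ∷ Unique.map⁻ (subst Unique (sym (lay-segment i))
                                      (layersBetween-unique (height i) (height (cyclicSuc i))))

  chunks-disjoint : ∀ {i j} → i ≢ j → Disjoint (v i ∷ segment i) (v j ∷ segment j)
  chunks-disjoint i≢j (here refl , here eq)  = i≢j (v-injective eq)
  chunks-disjoint _   (here refl , there x∈) = segment-unoccupied x∈ (_ , refl)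
  chunks-disjoint _   (there x∈ , here refl) = segment-unoccupied x∈ (_ , refl)
  chunks-disjoint i≢j (there x∈ , there x∈′) with ∈-segment⁻ x∈ | ∈-segment⁻ x∈′
  ... | _ , c , refl | _ , c′ , eq = i≢j (waypoint-injective c c′ eq)

  chunk-linked : ∀ i → Linked (Close on lay) (v i ∷ segment i ++ [ v (cyclicSuc i) ])
  chunk-linked i = Linked.map⁻
    (subst (Linked Close) (sym lays) (layersBetween-linked (height i) (height (cyclicSuc i))))
    where
    lays : map lay (v i ∷ segment i ++ [ v (cyclicSuc i) ]) ≡ height i ∷ crossed i ++ [ height (cyclicSuc i) ]
    lays = cong (height i ∷_) (trans (map-++ lay (segment i) [ v (cyclicSuc i) ])
                                     (cong (_++ [ height (cyclicSuc i) ]) (lay-segment i)))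

  tour-cycle : 1 ≤ h → Σ (Cycle (layered lay)) λ C → ContainsInCyclicOrder C v
  tour-cycle h≥1 = cycleThrough (layered lay) _,_ v v-injective (s≤s (*-monoʳ-≤ 2 h≥1))
    (Unique.concat⁺ (All.tabulate⁺ chunk-unique) (AllPairs.tabulate⁺ chunks-disjoint))
    (chain-linked v segment chunk-linked) (chain-occurs v segment)

layered-ordered : ∀ {n} (lay : Fin n → ℕ) h → 1 ≤ h →
                  (∀ {x y ℓ} → lay x < ℓ → ℓ < lay y → 2 * h ≤ length (layer lay ℓ)) →
                  Ordered (suc (2 * h)) (layered lay)
layered-ordered lay h h≥1 thick v v-injective = Routing.tour-cycle lay h thick v v-injective h≥1

-- Distances in layered graphs

Walk-snoc : ∀ {n} {G : SimpleGraph n} {x y z ℓ} → Walk G x y ℓ → Adj G y z → Walk G x z (suc ℓ)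
Walk-snoc nil          y~z = cons y~z nil
Walk-snoc (cons x~w w) y~z = cons x~w (Walk-snoc w y~z)

Walk-reverse : ∀ {n} {G : SimpleGraph n} {x y ℓ} → Walk G x y ℓ → Walk G y x ℓ
Walk-reverse         nil          = nil
Walk-reverse {G = G} (cons x~w w) = Walk-snoc (Walk-reverse w) (SimpleGraph.sym G x~w)

module _ {n} (lay : Fin n → ℕ) where

  walk-lay-≤ : ∀ {x y ℓ} → Walk (layered lay) x y ℓ → lay y ≤ ℓ + lay x
  walk-lay-≤ nil = ≤-refl
  walk-lay-≤ {x} {y} (cons {w = w} {ℓ = ℓ} (_ , _ , w≤x+1) walk) = begin
    lay y            ≤⟨ walk-lay-≤ walk ⟩
    ℓ + lay w        ≤⟨ +-monoʳ-≤ ℓ w≤x+1 ⟩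
    ℓ + suc (lay x)  ≡⟨ +-suc ℓ (lay x) ⟩
    suc ℓ + lay x    ∎
    where open ≤-Reasoning

  adjacent-suc : ∀ {x y} → lay y ≡ suc (lay x) → Adj (layered lay) x y
  adjacent-suc {x} {y} y≡x+1 =
    (λ x≡y → 1+n≢n (trans (sym y≡x+1) (cong lay (sym x≡y)))) ,
    subst (Close (lay x)) (sym y≡x+1) (close-suc (lay x))

  module _ {D} (representative : ∀ {ℓ} → ℓ ≤ D → ∃ λ x → lay x ≡ ℓ) where

    climb : ∀ d {x y} → lay y ≡ suc d + lay x → lay y ≤ D → Walk (layered lay) x y (suc d)
    climb zero            y≡x+1 _   = cons (adjacent-suc y≡x+1) nil
    climb (suc d) {x} {y} y≡x+d y≤D = cons (adjacent-suc (proj₂ w)) (climb d y≡w+d y≤D)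
      where
      w = representative (≤-trans (s≤s (m≤n+m (lay x) (suc d))) (≤-trans (≤-reflexive (sym y≡x+d)) y≤D))

      y≡w+d : lay y ≡ suc d + lay (proj₁ w)
      y≡w+d = trans y≡x+d (trans (sym (+-suc (suc d) (lay x))) (cong (suc d +_) (sym (proj₂ w))))

    climb-distance : ∀ {x y} → lay x < lay y → lay y ≤ D → DistLE (layered lay) x y D
    climb-distance {x} {y} x<y y≤D =
      suc d , ≤-trans (≤-trans (m≤m+n (suc d) (lay x)) (≤-reflexive (sym y≡x+d))) y≤D ,
      climb d y≡x+d y≤D
      where
      d = lay y ∸ suc (lay x)

      y≡x+d : lay y ≡ suc d + lay x
      y≡x+d = sym (trans (sym (+-suc d (lay x))) (m∸n+n≡m x<y))

    layered-diameter : 1 ≤ D → (∀ x → lay x ≤ D) → HasDiameter (layered lay) D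
    layered-diameter D≥1 bounded = distance , proj₁ bottom , proj₁ top , far
      where
      bottom = representative z≤n
      top    = representative ≤-refl

      distance : ∀ x y → DistLE (layered lay) x y D
      distance x y with <-cmp (lay x) (lay y)
      ... | tri< x<y _ _ = climb-distance x<y (bounded y)
      ... | tri> _ _ y<x with climb-distance y<x (bounded x)
      ...   | ℓ , ℓ≤D , w = ℓ , ℓ≤D , Walk-reverse w
      distance x y | tri≈ _ x≈y _ with x Fin.≟ y
      ...   | yes refl = 0 , z≤n , nil
      ...   | no x≢y   = 1 , D≥1 , cons (x≢y , subst (Close (lay x)) x≈y (n≤1+n _ , n≤1+n _)) nil

      far : ∀ ℓ → ℓ < D → ¬ Walk (layered lay) (proj₁ bottom) (proj₁ top) ℓ
      far ℓ ℓ<D w = <⇒≱ ℓ<D (begin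
        D                        ≡⟨ proj₂ top ⟨
        lay (proj₁ top)          ≤⟨ walk-lay-≤ w ⟩
        ℓ + lay (proj₁ bottom)   ≡⟨ cong (ℓ +_) (proj₂ bottom) ⟩
        ℓ + 0                    ≡⟨ +-identityʳ ℓ ⟩
        ℓ                        ∎)
        where open ≤-Reasoning

-- Layers of equal size

block-shift : ∀ t q K₁ → suc t + q * suc K₁ + K₁ ≡ t + suc q * suc K₁
block-shift = solve-∀

-- Vertex 0 forms layer 0, the vertices 1 + q K, …, K + q K form layer q + 1 for q < m,
-- and the last two vertices form layer m + 1 (as K ≥ 2).
module Blocks (K₁ m : ℕ) where

  K : ℕ
  K = suc K₁

  layerOf : ℕ → ℕ
  layerOf i = (i + K₁) / K

  blockLayer : Fin (3 + m * K) → ℕ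
  blockLayer x = layerOf (toℕ x)

  layerOf-block : ∀ q {t} → t < K → layerOf (suc t + q * K) ≡ suc q
  layerOf-block q {t} t<K = begin
    (suc t + q * K + K₁) / K  ≡⟨ cong (_/ K) (block-shift t q K₁) ⟩
    (t + suc q * K) / K       ≡⟨ +-distrib-/-∣ʳ t (divides (suc q) refl) ⟩
    t / K + suc q * K / K     ≡⟨ cong₂ _+_ (m<n⇒m/n≡0 t<K) (m*n/n≡m (suc q) K) ⟩
    suc q                     ∎
    where open ≡-Reasoning

  blockLayer-bounded : 1 ≤ K₁ → ∀ x → blockLayer x ≤ suc m
  blockLayer-bounded K₁≥1 x = begin
    layerOf (toℕ x)      ≤⟨ /-monoˡ-≤ K (+-monoˡ-≤ K₁ (≤-pred (toℕ<n x))) ⟩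
    layerOf (2 + m * K)  ≡⟨ layerOf-block m (s≤s K₁≥1) ⟩
    suc m                ∎
    where open ≤-Reasoning

  representative : ∀ {ℓ} → ℓ ≤ suc m → ∃ λ x → blockLayer x ≡ ℓ
  representative {zero}  _     = zero , m<n⇒m/n≡0 (n<1+n K₁)
  representative {suc q} q<m+1 =
    fromℕ< q+1<n , trans (cong layerOf (toℕ-fromℕ< q+1<n)) (layerOf-block q (s≤s z≤n))
    where
    q+1<n : 1 + q * K < 3 + m * K
    q+1<n = s≤s (s≤s (m≤n⇒m≤1+n (*-monoˡ-≤ K (≤-pred q<m+1))))

  inner-layer-thick : 1 ≤ K₁ → ∀ {x y ℓ} → blockLayer x < ℓ → ℓ < blockLayer y →
                      K ≤ length (layer blockLayer ℓ)
  inner-layer-thick K₁≥1 {y = y} {ℓ = suc q} _ q+1<y = begin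
    K                                  ≡⟨ length-tabulate block ⟨
    length (tabulate block)            ≤⟨ unique-⊆⇒length≤ (Unique.tabulate⁺ block-injective)
                                                             block⊆layer ⟩
    length (layer blockLayer (suc q))  ∎
    where
    open ≤-Reasoning

    q<m : q < m
    q<m = ≤-pred (≤-trans q+1<y (blockLayer-bounded K₁≥1 y))

    block-bound : ∀ (t : Fin K) → suc (toℕ t) + q * K < 3 + m * K
    block-bound t = s≤s (m≤n⇒m≤o+n 2 (≤-trans (+-monoˡ-≤ (q * K) (toℕ<n t)) (*-monoˡ-≤ K q<m)))

    block : Fin K → Fin (3 + m * K)
    block t = fromℕ< (block-bound t)

    block-injective : ∀ {s t} → block s ≡ block t → s ≡ t
    block-injective {s} {t} eq = toℕ-injective (suc-injective (+-cancelʳ-≡ (q * K) _ _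
      (trans (sym (toℕ-fromℕ< (block-bound s))) (trans (cong toℕ eq) (toℕ-fromℕ< (block-bound t))))))

    block⊆layer : tabulate block ⊆ layer blockLayer (suc q)
    block⊆layer x∈ with ∈-tabulate⁻ {f = block} x∈
    ... | t , refl = ∈-filter⁺ (λ x → blockLayer x ≟ suc q) (∈-allFin (block t))
                       (trans (cong layerOf (toℕ-fromℕ< (block-bound t))) (layerOf-block q (toℕ<n t)))

theorem3p3 : ∀ (k : ℕ) → 2 ≤ k → ∀ (N : ℕ) →
    ∃ λ n → N ≤ n × Σ (SimpleGraph n) λ G →
      Ordered (2 * k + 1) G × HasDiameter G (((n ∸ 3) div (2 * k)) + 1)
theorem3p3 k (s≤s (s≤s z≤n)) N =
  3 + suc N * (2 * k) , N≤n , layered blockLayer ,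
  subst (λ r → Ordered r (layered blockLayer)) (+-comm 1 (2 * k))
    (layered-ordered blockLayer k (s≤s z≤n) λ {x} {y} → inner-layer-thick (s≤s z≤n) {x} {y}) ,
  subst (HasDiameter (layered blockLayer)) diameter≡
    (layered-diameter blockLayer representative (s≤s z≤n) (blockLayer-bounded (s≤s z≤n)))
  where
  open Blocks (2 * k ∸ 1) (suc N)

  N≤n : N ≤ 3 + suc N * (2 * k)
  N≤n = ≤-trans (n≤1+n N) (≤-trans (m≤m*n (suc N) (2 * k)) (m≤n+m _ 3))

  diameter≡ : suc (suc N) ≡ suc N * (2 * k) / (2 * k) + 1
  diameter≡ = trans (+-comm 1 (suc N)) (cong (_+ 1) (sym (m*n/n≡m (suc N) (2 * k))))
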